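{- Let $k\geq3$ and $n\geq 3$, and let $\mathbf{a}=(a_1,a_2,\dots,a_{n-1})$ be a vertex of $H_k(n-1)$. Then: if $k$ is odd, the in-degree and the out-degree of $\mathbf{a}$ in $H_k(n-1)$ are both $1$ if $w^*(\mathbf{a})\in\{kn/2-i:1\leq i\leq k-1\}$ or $w^*(\mathbf{a})=k(n-1)/2$, and both $0$ otherwise; if $k$ is even, the in-degree and the out-degree of $\mathbf{a}$ are both $2$ if $w^*(\mathbf{a})=k(n-1)/2$; otherwise both $1$ if $w^*(\mathbf{a})\in\{kn/2-i:1\leq i\leq k-1\}$; and both $0$ otherwise.
   Context: Tuples are $k$-ary (entries in $\mathbb{Z}_k$). The pseudoweight $w^*$ of $a\in\mathbb{Z}_k$ is $a$ (as an integer) if $a\ne0$ and $k/2$ if $a=0$; the pseudoweight $w^*$ of a tuple is the sum of the pseudoweights of its entries. $B_k(n-1)$ is the de Bruijn digraph with vertices the $k$-ary $(n-1)$-tuples and edges the $k$-ary $n$-tuples $(a_0,\dots,a_{n-1})$ from $(a_0,\dots,a_{n-2})$ to $(a_1,\dots,a_{n-1})$; $H_k(n-1)$ is the subgraph with all vertices of $B_k(n-1)$ and with edges those of pseudoweight exactly $kn/2$. -}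

module Defs where

open import Data.Nat using (ℕ; zero; suc; _+_; _*_; _∸_; _≤_)
open import Data.Nat.Properties using (_≟_)
open import Data.Fin using (Fin; zero; suc; toℕ)
open import Data.Fin.Base using ()
open import Data.List using (List; length; filter; allFin)
open import Data.Vec using (Vec; []; _∷_; _∷ʳ_)
open import Data.Product using (∃; _×_)
open import Relation.Binary.PropositionalEquality using (_≡_)

-- Twice the pseudoweight of an element of Z_k (represented as Fin k):
-- 2·w*(a) = 2a if a ≠ 0, and 2·(k/2) = k if a = 0.
-- (Doubling avoids the half-integer k/2 when k is odd.)
dw* : (k : ℕ) → Fin k → ℕ
dw* k zero    = k
dw* k (suc i) = 2 * suc (toℕ i)

DW* : (k : ℕ) {m : ℕ} → Vec (Fin k) m → ℕ
DW* k []       = 0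
DW* k (x ∷ xs) = dw* k x + DW* k xs

-- Edges of H_k(n-1): k-ary n-tuples e with w*(e) = kn/2, i.e. 2·w*(e) = k·n.
-- In B_k(n-1), the edges entering the vertex a = (a_1,…,a_{n-1}) are exactly
-- the n-tuples (b, a_1, …, a_{n-1}) for b ∈ Z_k, and those leaving it are
-- (a_1, …, a_{n-1}, b).
inDeg : (k n : ℕ) → Vec (Fin k) (n ∸ 1) → ℕ
inDeg k n a = length (filter (λ b → DW* k (b ∷ a) ≟ k * n) (allFin k))

outDeg : (k n : ℕ) → Vec (Fin k) (n ∸ 1) → ℕ
outDeg k n a = length (filter (λ b → DW* k (a ∷ʳ b) ≟ k * n) (allFin k))

InRange : (k n : ℕ) → Vec (Fin k) (n ∸ 1) → Set
InRange k n a = ∃ λ i → 1 ≤ i × i ≤ k ∸ 1 × DW* k a + 2 * i ≡ k * n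

Middle : (k n : ℕ) → Vec (Fin k) (n ∸ 1) → Set
Middle k n a = DW* k a ≡ k * (n ∸ 1)

{-# OPTIONS --safe #-}
-- The edges entering a and those leaving a both arise by adding one residue b
-- to a, so each degree counts the b ∈ Z_k with w*(b) = kn/2 − w*(a).  Since
-- w*(0) = k/2 and w*(b) = b otherwise, b = 0 works iff w*(a) = k(n−1)/2, and,
-- w* being injective on nonzero residues, exactly one b ≠ 0 works iff
-- w*(a) ∈ {kn/2 − i : 1 ≤ i ≤ k−1}.  Both happen at once only if that b is
-- k/2, whose pseudoweight equals w*(0): never for odd k, and for even k
-- whenever w*(a) = k(n−1)/2.
module Submission where

open import Defs
open import Data.Nat using (ℕ; zero; suc; _+_; _*_; _∸_; _≤_; z≤n; s≤s)
open import Data.Nat.Properties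
  using ( _≟_; +-comm; +-cancelˡ-≡; +-cancelʳ-≡; *-comm; *-suc; *-cancelˡ-≡; suc-injective; m≤m*n
        ; +-commutativeSemigroup)
open import Algebra.Properties.CommutativeSemigroup +-commutativeSemigroup using (x∙yz≈y∙xz)
open import Data.Nat.Divisibility using (_∣_; divides)
open import Data.Fin using (Fin; zero; suc; toℕ; fromℕ<)
open import Data.Fin.Properties using (toℕ-injective; toℕ<n; toℕ-fromℕ<)
import Data.Fin.Properties as Fin
open import Data.Vec using (Vec; []; _∷_; _∷ʳ_)
open import Data.List using (List; []; _∷_; [_]; length; filter; allFin; tabulate)
open import Data.List.Properties
  using (length-++; filter-++; filter-accept; filter-reject; filter-none; filter-≐)
open import Data.List.Membership.Propositional using (_∈_)
open import Data.List.Membership.Propositional.Properties using (∈-tabulate⁺)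
open import Data.List.Relation.Unary.Any using (here; there)
open import Data.List.Relation.Unary.All as All using (All; _∷_)
import Data.List.Relation.Unary.All.Properties as All
open import Data.List.Relation.Unary.Unique.Propositional using (Unique; _∷_)
import Data.List.Relation.Unary.Unique.Propositional.Properties as Unique
open import Data.Product using (∃; _×_; _,_)
open import Data.Sum using (_⊎_; inj₁; inj₂)
open import Function using (_∘_)
open import Relation.Nullary using (¬_)
open import Relation.Unary using (Pred; Decidable)
open import Relation.Binary.PropositionalEquality
  using (_≡_; refl; sym; trans; cong; cong₂; module ≡-Reasoning)

open ≡-Reasoning

length-filter-unique : ∀ {a p} {A : Set a} {P : Pred A p} (P? : Decidable P) {x : A} {xs : List A} →
                       Unique xs → x ∈ xs → P x → All (λ y → P y → y ≡ x) xs →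
                       length (filter P? xs) ≡ 1
length-filter-unique {P = P} P? {x} {x ∷ ys} (x∉ys ∷ _) (here refl) Px (_ ∷ P⇒≡x) = begin
  length (filter P? (x ∷ ys))  ≡⟨ cong length (filter-accept P? Px) ⟩
  suc (length (filter P? ys))  ≡⟨ cong (suc ∘ length) (filter-none P? ¬P) ⟩
  1                            ∎
  where
  ¬P : All (λ y → ¬ P y) ys
  ¬P = All.zipWith (λ (x≢y , Py⇒y≡x) Py → x≢y (sym (Py⇒y≡x Py))) (x∉ys , P⇒≡x)
length-filter-unique P? {x} {y ∷ ys} (y∉ys ∷ ys-unique) (there x∈ys) Px (Py⇒y≡x ∷ P⇒≡x) = begin
  length (filter P? (y ∷ ys))  ≡⟨ cong length (filter-reject P? (All.lookup y∉ys x∈ys ∘ Py⇒y≡x)) ⟩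
  length (filter P? ys)        ≡⟨ length-filter-unique P? ys-unique x∈ys Px P⇒≡x ⟩
  1                            ∎

dw*-suc-injective : ∀ {m} {i j : Fin m} → dw* (suc m) (suc i) ≡ dw* (suc m) (suc j) → i ≡ j
dw*-suc-injective = toℕ-injective ∘ suc-injective ∘ *-cancelˡ-≡ _ _ 2

DW*-∷ʳ : ∀ k {m} (a : Vec (Fin k) m) (b : Fin k) → DW* k (a ∷ʳ b) ≡ dw* k b + DW* k a
DW*-∷ʳ k []      b = refl
DW*-∷ʳ k (x ∷ a) b = begin
  dw* k x + DW* k (a ∷ʳ b)       ≡⟨ cong (dw* k x +_) (DW*-∷ʳ k a b) ⟩
  dw* k x + (dw* k b + DW* k a)  ≡⟨ x∙yz≈y∙xz (dw* k x) (dw* k b) (DW* k a) ⟩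
  dw* k b + (dw* k x + DW* k a)  ∎

outDeg≡inDeg : ∀ k n (a : Vec (Fin k) (n ∸ 1)) → outDeg k n a ≡ inDeg k n a
outDeg≡inDeg k n a = cong length (filter-≐ _ _ (to , from) (allFin k))
  where
  to : ∀ {b} → DW* k (a ∷ʳ b) ≡ k * n → DW* k (b ∷ a) ≡ k * n
  to {b} = trans (sym (DW*-∷ʳ k a b))
  from : ∀ {b} → DW* k (b ∷ a) ≡ k * n → DW* k (a ∷ʳ b) ≡ k * n
  from {b} = trans (DW*-∷ʳ k a b)

middle∧inRange⇒even : ∀ k n (a : Vec (Fin k) n) → Middle k (suc n) a → InRange k (suc n) a → 2 ∣ k
middle∧inRange⇒even k n a middle (i , _ , _ , e) = divides i (trans (sym 2i≡k) (*-comm 2 i))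
  where
  2i≡k : 2 * i ≡ k
  2i≡k = +-cancelˡ-≡ (k * n) _ _ (begin
    k * n + 2 * i    ≡⟨ cong (_+ 2 * i) middle ⟨
    DW* k a + 2 * i  ≡⟨ e ⟩
    k * suc n        ≡⟨ *-suc k n ⟩
    k + k * n        ≡⟨ +-comm k (k * n) ⟩
    k * n + k        ∎)

even∧middle⇒inRange : ∀ m n (a : Vec (Fin (suc m)) n) → 2 ∣ suc m →
                      Middle (suc m) (suc n) a → InRange (suc m) (suc n) a
even∧middle⇒inRange m n a (divides (suc q) k≡2q) middle = suc q , s≤s z≤n , q≤m , e
  where
  q≤m : suc q ≤ m
  q≤m rewrite suc-injective k≡2q = s≤s (m≤m*n q 2)
  e : DW* (suc m) a + 2 * suc q ≡ suc m * suc n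
  e = begin
    DW* (suc m) a + 2 * suc q    ≡⟨ cong₂ _+_ middle (trans (*-comm 2 (suc q)) (sym k≡2q)) ⟩
    suc m * n + suc m            ≡⟨ +-comm (suc m * n) (suc m) ⟩
    suc m + suc m * n            ≡⟨ *-suc (suc m) n ⟨
    suc m * suc n                ∎

module Degrees (m n : ℕ) (a : Vec (Fin (suc m)) n) where

  Completes : Fin (suc m) → Set
  Completes b = DW* (suc m) (b ∷ a) ≡ suc m * suc n

  completes? : Decidable Completes
  completes? b = DW* (suc m) (b ∷ a) ≟ suc m * suc n

  zeroCompletions nonzeroCompletions : List (Fin (suc m))
  zeroCompletions    = filter completes? [ zero ]
  nonzeroCompletions = filter completes? (tabulate suc)

  -- allFin (suc m) is definitionally [ zero ] ++ tabulate suc.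
  inDeg-split : inDeg (suc m) (suc n) a ≡ length zeroCompletions + length nonzeroCompletions
  inDeg-split =
    trans (cong length (filter-++ completes? [ zero ] (tabulate suc))) (length-++ zeroCompletions)

  degrees : ∀ {x y} → length zeroCompletions ≡ x → length nonzeroCompletions ≡ y →
            inDeg (suc m) (suc n) a ≡ x + y × outDeg (suc m) (suc n) a ≡ x + y
  degrees {x} {y} zero≡x nonzero≡y = inDeg≡x+y , trans (outDeg≡inDeg (suc m) (suc n) a) inDeg≡x+y
    where
    inDeg≡x+y : inDeg (suc m) (suc n) a ≡ x + y
    inDeg≡x+y = trans inDeg-split (cong₂ _+_ zero≡x nonzero≡y)

  middle⇒completes : Middle (suc m) (suc n) a → Completes zero
  middle⇒completes middle = trans (cong (suc m +_) middle) (sym (*-suc (suc m) n))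

  completes⇒middle : Completes zero → Middle (suc m) (suc n) a
  completes⇒middle e = +-cancelˡ-≡ (suc m) _ _ (trans e (*-suc (suc m) n))

  inRange⇒completes : InRange (suc m) (suc n) a → ∃ λ (i : Fin m) → Completes (suc i)
  inRange⇒completes (suc j , _ , j<m , e) = fromℕ< j<m , (begin
    2 * suc (toℕ (fromℕ< j<m)) + DW* (suc m) a  ≡⟨ cong (λ t → 2 * suc t + DW* (suc m) a) (toℕ-fromℕ< j<m) ⟩
    2 * suc j + DW* (suc m) a                   ≡⟨ +-comm (2 * suc j) _ ⟩
    DW* (suc m) a + 2 * suc j                   ≡⟨ e ⟩
    suc m * suc n                               ∎)

  completes⇒inRange : (i : Fin m) → Completes (suc i) → InRange (suc m) (suc n) a
  completes⇒inRange i e = suc (toℕ i) , s≤s z≤n , toℕ<n i , trans (+-comm (DW* (suc m) a) _) e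

  zeroCompletions-middle : Middle (suc m) (suc n) a → length zeroCompletions ≡ 1
  zeroCompletions-middle middle =
    cong length (filter-accept completes? {x = zero} {xs = []} (middle⇒completes middle))

  zeroCompletions-¬middle : ¬ Middle (suc m) (suc n) a → length zeroCompletions ≡ 0
  zeroCompletions-¬middle ¬middle =
    cong length (filter-reject completes? {x = zero} {xs = []} (¬middle ∘ completes⇒middle))

  nonzeroCompletions-inRange : InRange (suc m) (suc n) a → length nonzeroCompletions ≡ 1
  nonzeroCompletions-inRange = unique ∘ inRange⇒completes
    where
    unique : (∃ λ (i : Fin m) → Completes (suc i)) → length nonzeroCompletions ≡ 1
    unique (i , e) =
      length-filter-unique completes? (Unique.tabulate⁺ Fin.suc-injective) (∈-tabulate⁺ i) e
        (All.tabulate⁺ λ j e′ →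
          cong suc (dw*-suc-injective (+-cancelʳ-≡ (DW* (suc m) a) _ _ (trans e′ (sym e)))))

  nonzeroCompletions-¬inRange : ¬ InRange (suc m) (suc n) a → length nonzeroCompletions ≡ 0
  nonzeroCompletions-¬inRange ¬inRange =
    cong length (filter-none completes? (All.tabulate⁺ λ i → ¬inRange ∘ completes⇒inRange i))

lemma2p1 : (k n : ℕ) → 3 ≤ k → 3 ≤ n → (a : Vec (Fin k) (n ∸ 1)) →
    (¬ (2 ∣ k) →
      ((InRange k n a ⊎ Middle k n a) → inDeg k n a ≡ 1 × outDeg k n a ≡ 1)
      × ((¬ InRange k n a × ¬ Middle k n a) → inDeg k n a ≡ 0 × outDeg k n a ≡ 0))
    × (2 ∣ k →
      (Middle k n a → inDeg k n a ≡ 2 × outDeg k n a ≡ 2)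
      × ((¬ Middle k n a × InRange k n a) → inDeg k n a ≡ 1 × outDeg k n a ≡ 1)
      × ((¬ Middle k n a × ¬ InRange k n a) → inDeg k n a ≡ 0 × outDeg k n a ≡ 0))
lemma2p1 (suc m) (suc n) _ _ a =
    (λ odd →
        (λ { (inj₁ inRange) →
               degrees (zeroCompletions-¬middle λ middle → odd (middle∧inRange⇒even _ n a middle inRange))
                       (nonzeroCompletions-inRange inRange)
           ; (inj₂ middle) →
               degrees (zeroCompletions-middle middle)
                       (nonzeroCompletions-¬inRange (odd ∘ middle∧inRange⇒even _ n a middle)) })
      , λ (¬inRange , ¬middle) →
          degrees (zeroCompletions-¬middle ¬middle) (nonzeroCompletions-¬inRange ¬inRange))
  , (λ even →
        (λ middle →
          degrees (zeroCompletions-middle middle)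
                  (nonzeroCompletions-inRange (even∧middle⇒inRange m n a even middle)))
      , (λ (¬middle , inRange) →
          degrees (zeroCompletions-¬middle ¬middle) (nonzeroCompletions-inRange inRange))
      , (λ (¬middle , ¬inRange) →
          degrees (zeroCompletions-¬middle ¬middle) (nonzeroCompletions-¬inRange ¬inRange)))
  where open Degrees m n a
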